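{- Let $T \in \mathfrak F(x,L)$ and $i \in S(x,L)$ be such that $T_i \leq \overline{L}_i$. If $j \in [n]$ is such that $N((x,L),i)_j \in \mathfrak L$, then $T_j \leq N((x,L),i)_j$.
   Context: Let $k \geq 2$, let $\mathfrak T$ be a star on $k+1$ vertices with root ${\bf o}$ and set of leaves $\mathfrak L$ ($|\mathfrak L| = k$). On $\mathfrak T$ the operations $\sqcap,\sqcup$ are idempotent, and for distinct leaves $a,b$: $a \sqcap b = a \sqcup b = {\bf o}$, $a \sqcap {\bf o} = {\bf o} \sqcap a = {\bf o}$, $a \sqcup {\bf o} = {\bf o} \sqcup a = a$; on $\mathfrak T^n$ they act componentwise, and ${\bf 0} = ({\bf o})_{i=1}^n$. Let $\leq$ be the partial order on $\mathfrak T$ with ${\bf o} \leq t$ for all $t$ and leaves pairwise incomparable. Let $f:\mathfrak T^n \to \mathbb R$ be $k$-submodular, i.e. $f(T\sqcap U)+f(T\sqcup U)\le f(T)+f(U)$ for all $T,U$, with $f({\bf 0})=0$. For $(x,L) \in \mathbb R_{\geq 0}^n \times \mathfrak L^n$ define $\overline{(x,L)}(T) = \sum_{i=1}^n \overline{(x,L)}_i(T_i)$ where $\overline{(x,L)}_i({\bf o}) = 0$, $\overline{(x,L)}_i(L_i) = x_i$, and $\overline{(x,L)}_i(\ell) = -x_i$ for $\ell \in \mathfrak L\setminus\{L_i\}$. Let $U(f) = \{(x,L) \in \mathbb R_{\geq 0}^n \times \mathfrak L^n : \overline{(x,L)}(T) \leq f(T)\ \forall T \in \mathfrak T^n\}$.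 Fix $(x,L) \in U(f)$. Let $\mathfrak F(x,L) = \{T \in \mathfrak T^n : \overline{(x,L)}(T) = f(T)\}$ be the set of $(x,L)$-tight elements (it is closed under $\sqcap$ and $\sqcup$). Let $S(x,L) = \{i \in \operatorname{supp}(x) : \exists\, T \in \mathfrak F(x,L) \text{ with } T_i \in \mathfrak L\setminus\{L_i\}\}$. For $i \in S(x,L)$, the leaf $T_i \in \mathfrak L\setminus\{L_i\}$ is the same for all such tight $T$; denote it $\overline{L}_i$. Define $N((x,L),i)$ as the componentwise meet (iterated $\sqcap$, which is associative) of all $T \in \mathfrak F(x,L)$ with $T_i = \overline{L}_i$. -}

module Defs where

open import Level using (0ℓ) renaming (suc to lsuc)
open import Data.Nat using (ℕ; zero; suc)
open import Data.Fin using (Fin) renaming (zero to fzero; suc to fsuc)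
import Data.Fin as Fin
open import Data.Product using (Σ-syntax; _×_)
open import Data.List.NonEmpty using (List⁺; toList; foldr₁)
open import Data.List.Membership.Propositional using (_∈_)
open import Function using (_∘_; _⇔_)
open import Relation.Nullary using (¬_; yes; no)
open import Relation.Binary.Core using (Rel)
open import Relation.Binary.Structures using (IsTotalOrder)
open import Relation.Binary.PropositionalEquality using (_≡_; _≢_)
open import Algebra.Bundles using (AbelianGroup)

-- The star 𝔗 on k+1 vertices: root o and leaves leaf a (a : Fin k).

data Star (k : ℕ) : Set where
  o    : Star k
  leaf : Fin k → Star k

module _ {k : ℕ} where

  infixl 7 _⊓_
  infixl 6 _⊔_

  _⊓_ : Star k → Star k → Star k
  o      ⊓ _      = o
  leaf a ⊓ o      = o
  leaf a ⊓ leaf b with a Fin.≟ b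
  ... | yes _ = leaf a
  ... | no  _ = o

  _⊔_ : Star k → Star k → Star k
  o      ⊔ t      = t
  leaf a ⊔ o      = leaf a
  leaf a ⊔ leaf b with a Fin.≟ b
  ... | yes _ = leaf a
  ... | no  _ = o

  infix 4 _≼_
  data _≼_ : Star k → Star k → Set where
    o≼    : ∀ {t} → o ≼ t
    leaf≼ : ∀ {a} → leaf a ≼ leaf a

Tuple : ℕ → ℕ → Set
Tuple k n = Fin n → Star k

module _ {k n : ℕ} where
  infixl 7 _⊓ᵛ_
  infixl 6 _⊔ᵛ_

  _⊓ᵛ_ : Tuple k n → Tuple k n → Tuple k n
  (T ⊓ᵛ U) i = T i ⊓ U i

  _⊔ᵛ_ : Tuple k n → Tuple k n → Tuple k n
  (T ⊔ᵛ U) i = T i ⊔ U i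

  𝟎 : Tuple k n
  𝟎 _ = o

-- Totally ordered abelian group (abstracting the additive ordered
-- group of ℝ, which is not available in agda-stdlib).

record OrderedAbelianGroup : Set (lsuc 0ℓ) where
  field
    abelianGroup : AbelianGroup 0ℓ 0ℓ
  open AbelianGroup abelianGroup public
  infix 4 _≤_
  field
    _≤_          : Rel Carrier 0ℓ
    isTotalOrder : IsTotalOrder _≈_ _≤_
    ∙-monoˡ-≤    : ∀ {a b} c → a ≤ b → (a ∙ c) ≤ (b ∙ c)

module Setup (G : OrderedAbelianGroup) where
  open OrderedAbelianGroup G public

  ∑ : ∀ {n} → (Fin n → Carrier) → Carrier
  ∑ {zero}  g = ε
  ∑ {suc n} g = g fzero ∙ ∑ (g ∘ fsuc)

  module _ {k n : ℕ} where

    KSubmodular : (Tuple k n → Carrier) → Set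
    KSubmodular f = ∀ T U → (f (T ⊓ᵛ U) ∙ f (T ⊔ᵛ U)) ≤ (f T ∙ f U)

    xbarᵢ : Carrier → Fin k → Star k → Carrier
    xbarᵢ xᵢ Lᵢ o = ε
    xbarᵢ xᵢ Lᵢ (leaf a) with a Fin.≟ Lᵢ
    ... | yes _ = xᵢ
    ... | no  _ = xᵢ ⁻¹

    xbar : (Fin n → Carrier) → (Fin n → Fin k) → Tuple k n → Carrier
    xbar x L T = ∑ (λ i → xbarᵢ (x i) (L i) (T i))

    InU : (Tuple k n → Carrier) → (Fin n → Carrier) → (Fin n → Fin k) → Set
    InU f x L = (∀ i → ε ≤ x i) × (∀ T → xbar x L T ≤ f T)

    Tight : (Tuple k n → Carrier) → (Fin n → Carrier) → (Fin n → Fin k) → Tuple k n → Set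
    Tight f x L T = xbar x L T ≈ f T

    InSupp : (Fin n → Carrier) → Fin n → Set
    InSupp x i = ¬ (x i ≈ ε)

    -- i ∈ S(x,L) and ℓ̄ is the leaf \overline{L}_i (a leaf ≠ L_i taken at
    -- coordinate i by some tight element; unique by the context).
    InSWith : (Tuple k n → Carrier) → (Fin n → Carrier) → (Fin n → Fin k) →
              Fin n → Fin k → Set
    InSWith f x L i ℓ̄ =
      InSupp x i × ℓ̄ ≢ L i × Σ[ T ∈ Tuple k n ] (Tight f x L T × T i ≡ leaf ℓ̄)

    Enumerates : (Tuple k n → Carrier) → (Fin n → Carrier) → (Fin n → Fin k) →
                 Fin n → Fin k → List⁺ (Tuple k n) → Set
    Enumerates f x L i ℓ̄ Ts =
      ∀ T → (T ∈ toList Ts) ⇔ (Tight f x L T × T i ≡ leaf ℓ̄)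

    -- N((x,L),i): the iterated meet of the enumerated elements
    meetAll : List⁺ (Tuple k n) → Tuple k n
    meetAll = foldr₁ _⊓ᵛ_

-- The tight elements are closed under ⊓ᵛ and ⊔ᵛ, because \overline{(x,L)}
-- is supermodular on 𝔗ⁿ whereas f is submodular and dominates it.  Hence
-- N = N((x,L),i) is tight with Nᵢ = ℓ̄, and so is T ⊔ᵛ N, since Tᵢ ≼ ℓ̄.
-- Thus T ⊔ᵛ N is one of the elements whose meet is N, i.e. N ≼ T ⊔ᵛ N.
-- At a coordinate j where Nⱼ is a leaf a this reads a ≼ Tⱼ ⊔ a, which in
-- the star forces Tⱼ ≼ a.
module Submission where

open import Defs
open import Data.Nat using (ℕ; zero; suc)
open import Data.Fin using (Fin) renaming (zero to fzero; suc to fsuc)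
import Data.Fin as Fin
open import Data.List using ([]; _∷_)
open import Data.List.NonEmpty using (List⁺; _∷_; toList; foldr₁)
open import Data.List.Membership.Propositional using (_∈_)
open import Data.List.Relation.Unary.Any using (here; there)
open import Data.Product using (_×_; _,_; proj₁; proj₂)
open import Function using (Equivalence)
open import Relation.Nullary using (yes; no)
open import Relation.Binary.Bundles using (Poset)
open import Relation.Binary.Structures using (IsTotalOrder; IsPartialOrder)
open import Relation.Binary.PropositionalEquality
  using (_≡_; refl; cong; cong₂; subst; sym; trans)
import Algebra.Properties.Group as GroupProperties
import Algebra.Properties.CommutativeSemigroup as CommutativeSemigroupProperties
import Relation.Binary.Reasoning.PartialOrder as PosetReasoning

module _ {k : ℕ} where

  ≼-refl : (t : Star k) → t ≼ t
  ≼-refl o        = o≼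
  ≼-refl (leaf _) = leaf≼

  ≼-trans : {s t u : Star k} → s ≼ t → t ≼ u → s ≼ u
  ≼-trans o≼    _     = o≼
  ≼-trans leaf≼ leaf≼ = leaf≼

  ⊓-lowerˡ : (s t : Star k) → s ⊓ t ≼ s
  ⊓-lowerˡ o        _        = o≼
  ⊓-lowerˡ (leaf a) o        = o≼
  ⊓-lowerˡ (leaf a) (leaf b) with a Fin.≟ b
  ... | yes _ = leaf≼
  ... | no  _ = o≼

  ⊓-lowerʳ : (s t : Star k) → s ⊓ t ≼ t
  ⊓-lowerʳ o        _        = o≼
  ⊓-lowerʳ (leaf a) o        = o≼
  ⊓-lowerʳ (leaf a) (leaf b) with a Fin.≟ b
  ... | yes refl = leaf≼
  ... | no  _    = o≼

  ⊓-idem : (t : Star k) → t ⊓ t ≡ t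
  ⊓-idem o = refl
  ⊓-idem (leaf a) with a Fin.≟ a
  ... | yes _   = refl
  ... | no  a≢a with () ← a≢a refl

  s≼t⇒s⊔t≡t : {s t : Star k} → s ≼ t → s ⊔ t ≡ t
  s≼t⇒s⊔t≡t o≼ = refl
  s≼t⇒s⊔t≡t (leaf≼ {a}) with a Fin.≟ a
  ... | yes _   = refl
  ... | no  a≢a with () ← a≢a refl

  leaf≼s⊔leaf⇒s≼leaf : (s : Star k) (a : Fin k) → leaf a ≼ s ⊔ leaf a → s ≼ leaf a
  leaf≼s⊔leaf⇒s≼leaf o        a _ = o≼
  leaf≼s⊔leaf⇒s≼leaf (leaf b) a p with b Fin.≟ a | p
  ... | yes refl | _ = leaf≼
  ... | no  _    | ()

module _ {A : Set} (_∙_ : A → A → A) where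

  foldr₁-closed : (P : A → Set) → (∀ {a b} → P a → P b → P (a ∙ b)) →
                  (xs : List⁺ A) → (∀ {a} → a ∈ toList xs → P a) → P (foldr₁ _∙_ xs)
  foldr₁-closed P P-∙ (x ∷ xs) = go x xs
    where
    go : ∀ x xs → (∀ {a} → a ∈ x ∷ xs → P a) → P (foldr₁ _∙_ (x ∷ xs))
    go x []       P-xs = P-xs (here refl)
    go x (y ∷ ys) P-xs = P-∙ (P-xs (here refl)) (go y ys (λ a∈ → P-xs (there a∈)))

  foldr₁-lowerBound : (_⊑_ : A → A → Set) →
                      (∀ {a} → a ⊑ a) → (∀ {a b c} → a ⊑ b → b ⊑ c → a ⊑ c) →
                      (∀ a b → (a ∙ b) ⊑ a) → (∀ a b → (a ∙ b) ⊑ b) →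
                      (xs : List⁺ A) → ∀ {a} → a ∈ toList xs → foldr₁ _∙_ xs ⊑ a
  foldr₁-lowerBound _⊑_ ⊑-refl ⊑-trans lowerˡ lowerʳ (x ∷ xs) = go x xs
    where
    go : ∀ x xs {a} → a ∈ x ∷ xs → foldr₁ _∙_ (x ∷ xs) ⊑ a
    go x []       (here refl) = ⊑-refl
    go x (y ∷ ys) (here refl) = lowerˡ x _
    go x (y ∷ ys) (there a∈)  = ⊑-trans (lowerʳ x _) (go y ys a∈)

⊓ᵛ-foldr₁-lowerBound : {k n : ℕ} (Ts : List⁺ (Tuple k n)) {T : Tuple k n} →
                       T ∈ toList Ts → ∀ j → foldr₁ _⊓ᵛ_ Ts j ≼ T j
⊓ᵛ-foldr₁-lowerBound Ts =
  foldr₁-lowerBound _⊓ᵛ_ (λ M T → ∀ j → M j ≼ T j)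
    (λ j → ≼-refl _) (λ p q j → ≼-trans (p j) (q j))
    (λ M T j → ⊓-lowerˡ (M j) (T j)) (λ M T j → ⊓-lowerʳ (M j) (T j)) Ts

module OrderedAbelianGroupProperties (G : OrderedAbelianGroup) where
  open Setup G renaming (refl to ≈-refl; sym to ≈-sym; trans to ≈-trans)
  open IsTotalOrder isTotalOrder using (antisym; isPartialOrder)
  open IsPartialOrder isPartialOrder using ()
    renaming (refl to ≤-refl; trans to ≤-trans; reflexive to ≤-reflexive)
  open GroupProperties group using (∙-cancelˡ; ∙-cancelʳ)
  open CommutativeSemigroupProperties commutativeSemigroup using (interchange)

  poset : Poset _ _ _
  poset = record { isPartialOrder = isPartialOrder }

  open PosetReasoning poset

  ∙-mono-≤ : ∀ {a b c d} → a ≤ b → c ≤ d → (a ∙ c) ≤ (b ∙ d)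
  ∙-mono-≤ {a} {b} {c} {d} a≤b c≤d = begin
    a ∙ c ≤⟨ ∙-monoˡ-≤ c a≤b ⟩
    b ∙ c ≈⟨ comm b c ⟩
    c ∙ b ≤⟨ ∙-monoˡ-≤ b c≤d ⟩
    d ∙ b ≈⟨ comm d b ⟩
    b ∙ d ∎

  ε≤x⇒x⁻¹≤ε : ∀ {x} → ε ≤ x → x ⁻¹ ≤ ε
  ε≤x⇒x⁻¹≤ε {x} ε≤x = begin
    x ⁻¹     ≈⟨ identityˡ (x ⁻¹) ⟨
    ε ∙ x ⁻¹ ≤⟨ ∙-monoˡ-≤ (x ⁻¹) ε≤x ⟩
    x ∙ x ⁻¹ ≈⟨ inverseʳ x ⟩
    ε        ∎

  ∑-homo : ∀ {n} (g h : Fin n → Carrier) → (∑ g ∙ ∑ h) ≈ ∑ (λ i → g i ∙ h i)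
  ∑-homo {zero}  g h = identityˡ ε
  ∑-homo {suc n} g h = ≈-trans (interchange _ _ _ _)
    (∙-congˡ (∑-homo (λ i → g (fsuc i)) (λ i → h (fsuc i))))

  ∑-mono-≤ : ∀ {n} {g h : Fin n → Carrier} → (∀ i → g i ≤ h i) → ∑ g ≤ ∑ h
  ∑-mono-≤ {zero}  g≤h = ≤-refl
  ∑-mono-≤ {suc n} g≤h = ∙-mono-≤ (g≤h fzero) (∑-mono-≤ (λ i → g≤h (fsuc i)))

  ≤-squeeze : ∀ {a a′ b b′} → a ≤ a′ → b ≤ b′ → (a′ ∙ b′) ≤ (a ∙ b) → a ≈ a′ × b ≈ b′
  ≤-squeeze {a} {a′} {b} {b′} a≤a′ b≤b′ a′b′≤ab =
    ∙-cancelʳ b a a′ (antisym (∙-monoˡ-≤ b a≤a′) (≤-trans (∙-mono-≤ ≤-refl b≤b′) a′b′≤ab)) ,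
    ∙-cancelˡ a b b′ (antisym (∙-mono-≤ ≤-refl b≤b′) (≤-trans (∙-monoˡ-≤ b′ a≤a′) a′b′≤ab))

  module _ {k n : ℕ} where

    xbarᵢ-supermodular : ∀ {x} (ℓ : Fin k) → ε ≤ x → (s t : Star k) →
      (xbarᵢ {k} {n} x ℓ s ∙ xbarᵢ {k} {n} x ℓ t) ≤
      (xbarᵢ {k} {n} x ℓ (s ⊓ t) ∙ xbarᵢ {k} {n} x ℓ (s ⊔ t))
    xbarᵢ-supermodular ℓ ε≤x o        t        = ≤-refl
    xbarᵢ-supermodular ℓ ε≤x (leaf a) o        = ≤-reflexive (comm _ _)
    xbarᵢ-supermodular {x} ℓ ε≤x (leaf a) (leaf b) with a Fin.≟ b
    ... | yes refl = ≤-refl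
    ... | no  a≢b with a Fin.≟ ℓ | b Fin.≟ ℓ
    ...   | yes refl | yes refl with () ← a≢b refl
    ...   | yes _    | no  _    = ≤-reflexive (≈-trans (inverseʳ x) (≈-sym (identityˡ ε)))
    ...   | no  _    | yes _    = ≤-reflexive (≈-trans (inverseˡ x) (≈-sym (identityˡ ε)))
    ...   | no  _    | no  _    = ∙-mono-≤ (ε≤x⇒x⁻¹≤ε ε≤x) (ε≤x⇒x⁻¹≤ε ε≤x)

    xbar-supermodular : (x : Fin n → Carrier) (L : Fin n → Fin k) → (∀ i → ε ≤ x i) →
      ∀ T U → (xbar x L T ∙ xbar x L U) ≤ (xbar x L (T ⊓ᵛ U) ∙ xbar x L (T ⊔ᵛ U))
    xbar-supermodular x L x≥ε T U = begin
      xbar x L T ∙ xbar x L U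
        ≈⟨ ∑-homo (λ i → x̄ i (T i)) (λ i → x̄ i (U i)) ⟩
      ∑ (λ i → x̄ i (T i) ∙ x̄ i (U i))
        ≤⟨ ∑-mono-≤ (λ i → xbarᵢ-supermodular (L i) (x≥ε i) (T i) (U i)) ⟩
      ∑ (λ i → x̄ i (T i ⊓ U i) ∙ x̄ i (T i ⊔ U i))
        ≈⟨ ∑-homo (λ i → x̄ i (T i ⊓ U i)) (λ i → x̄ i (T i ⊔ U i)) ⟨
      xbar x L (T ⊓ᵛ U) ∙ xbar x L (T ⊔ᵛ U) ∎
      where
      x̄ : Fin n → Star k → Carrier
      x̄ i = xbarᵢ {k} {n} (x i) (L i)

    module _ {f : Tuple k n → Carrier} (f-submodular : KSubmodular f)
             {x : Fin n → Carrier} {L : Fin n → Fin k} (xL∈U : InU f x L) where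

      Tight-⊓ᵛ-⊔ᵛ : ∀ {T U} → Tight f x L T → Tight f x L U →
                    Tight f x L (T ⊓ᵛ U) × Tight f x L (T ⊔ᵛ U)
      Tight-⊓ᵛ-⊔ᵛ {T} {U} T-tight U-tight =
        ≤-squeeze (proj₂ xL∈U (T ⊓ᵛ U)) (proj₂ xL∈U (T ⊔ᵛ U)) (begin
          f (T ⊓ᵛ U) ∙ f (T ⊔ᵛ U)                 ≤⟨ f-submodular T U ⟩
          f T ∙ f U                               ≈⟨ ∙-cong T-tight U-tight ⟨
          xbar x L T ∙ xbar x L U                 ≤⟨ xbar-supermodular x L (proj₁ xL∈U) T U ⟩
          xbar x L (T ⊓ᵛ U) ∙ xbar x L (T ⊔ᵛ U)   ∎)

      Tight-meetAll : ∀ i (t : Star k) (Ts : List⁺ (Tuple k n)) →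
                      (∀ {M} → M ∈ toList Ts → Tight f x L M × M i ≡ t) →
                      Tight f x L (meetAll Ts) × meetAll Ts i ≡ t
      Tight-meetAll i t = foldr₁-closed _⊓ᵛ_ (λ M → Tight f x L M × M i ≡ t)
        λ (M-tight , Mᵢ≡t) (N-tight , Nᵢ≡t) →
          proj₁ (Tight-⊓ᵛ-⊔ᵛ M-tight N-tight) , trans (cong₂ _⊓_ Mᵢ≡t Nᵢ≡t) (⊓-idem t)

open import Data.Nat using (_≤_)

lemma4 : (G : OrderedAbelianGroup) → {k n : ℕ} → 2 ≤ k → let open Setup G in
    (f : Tuple k n → Carrier) → KSubmodular f → f 𝟎 ≈ ε →
    (x : Fin n → Carrier) (L : Fin n → Fin k) → InU f x L →
    (T : Tuple k n) → Tight f x L T →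
    (i : Fin n) (ℓ̄ : Fin k) → InSWith f x L i ℓ̄ → T i ≼ leaf ℓ̄ →
    (Ts : List⁺ (Tuple k n)) → Enumerates f x L i ℓ̄ Ts →
    (j : Fin n) (a : Fin k) → meetAll Ts j ≡ leaf a →
    T j ≼ meetAll Ts j
lemma4 G {k} {n} _ f f-submodular _ x L xL∈U T T-tight i ℓ̄ _ Tᵢ≼ℓ̄ Ts Ts-enumerates j a Nⱼ≡a =
  subst (T j ≼_) (sym Nⱼ≡a) (leaf≼s⊔leaf⇒s≼leaf (T j) a leaf≼Tⱼ⊔a)
  where
  open Setup G using (meetAll; Tight)
  open OrderedAbelianGroupProperties G
  open Equivalence using (to; from)
  N : Tuple k n
  N = meetAll Ts
  N-tight×Nᵢ≡ℓ̄ : Tight f x L N × N i ≡ leaf ℓ̄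
  N-tight×Nᵢ≡ℓ̄ = Tight-meetAll f-submodular xL∈U i (leaf ℓ̄) Ts (to (Ts-enumerates _))
  T⊔N∈Ts : (T ⊔ᵛ N) ∈ toList Ts
  T⊔N∈Ts = from (Ts-enumerates (T ⊔ᵛ N))
    ( proj₂ (Tight-⊓ᵛ-⊔ᵛ f-submodular xL∈U T-tight (proj₁ N-tight×Nᵢ≡ℓ̄))
    , trans (cong (T i ⊔_) (proj₂ N-tight×Nᵢ≡ℓ̄)) (s≼t⇒s⊔t≡t Tᵢ≼ℓ̄))
  leaf≼Tⱼ⊔a : leaf a ≼ T j ⊔ leaf a
  leaf≼Tⱼ⊔a = subst (λ t → t ≼ T j ⊔ t) Nⱼ≡a (⊓ᵛ-foldr₁-lowerBound Ts T⊔N∈Ts j)
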